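{- For all $n\ge 0$ and $0\le k\le n$, $s_n^k(321)=|SR_n(k)|$.
   Context: $s_n^k(321)$ is the number of permutations $\pi=\pi_1\cdots\pi_n$ of $\{1,\dots,n\}$ avoiding $321$ (no indices $i<j<l$ with $\pi_i>\pi_j>\pi_l$) with exactly $k$ fixed points (indices $i$ with $\pi_i=i$). The set of similarity relations on $\{1,\dots,n\}$ is encoded as the set of integer sequences $SR_n=\{r_1r_2\cdots r_n: r_1=0,\ 0\le r_{i+1}\le r_i+1 \text{ for } 1\le i\le n-1\}$ ($SR_0$ consists of the empty sequence). An index $i$ is an isolated point of $r\in SR_n$ if $r_i=0$ and either $i=n$ or $r_{i+1}=0$. $SR_n(k)$ is the set of $r\in SR_n$ with exactly $k$ isolated points. -}

module Defs where

open import Data.Nat using (ℕ; zero; suc; _+_; _≤_)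
open import Data.Fin using (Fin; toℕ) renaming (_<_ to _<ᶠ_)
import Data.Fin as F
open import Data.Vec using (Vec; []; _∷_; lookup)
open import Data.List using (List; length; filter; allFin)
open import Data.Product using (_×_; Σ; _,_)
open import Data.Unit using (⊤)
open import Relation.Nullary using (¬_)
open import Relation.Binary.PropositionalEquality using (_≡_)
open import Function.Definitions using (Injective)

-- A permutation π = π₁⋯πₙ of {1,…,n} is represented (0-indexed) as a word
-- π : Vec (Fin n) n whose position map i ↦ πᵢ is injective (hence bijective).
IsPerm : {n : ℕ} → Vec (Fin n) n → Set
IsPerm π = Injective _≡_ _≡_ (lookup π)

Avoids321 : {n : ℕ} → Vec (Fin n) n → Set
Avoids321 {n} π =
  (i j l : Fin n) → i <ᶠ j → j <ᶠ l →
  ¬ (lookup π j <ᶠ lookup π i × lookup π l <ᶠ lookup π j)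

fixedPoints : {n : ℕ} → Vec (Fin n) n → ℕ
fixedPoints {n} π = length (filter (λ i → lookup π i F.≟ i) (allFin n))

Perm321 : (n k : ℕ) → Vec (Fin n) n → Set
Perm321 n k π = IsPerm π × Avoids321 π × fixedPoints π ≡ k

data Steps : {n : ℕ} → Vec ℕ n → Set where
  steps[]  : Steps []
  steps[_] : (x : ℕ) → Steps (x ∷ [])
  steps∷   : {n : ℕ} {x y : ℕ} {xs : Vec ℕ n} →
             y ≤ suc x → Steps (y ∷ xs) → Steps (x ∷ y ∷ xs)

IsSR : {n : ℕ} → Vec ℕ n → Set
IsSR []       = ⊤
IsSR (x ∷ xs) = x ≡ 0 × Steps (x ∷ xs)

isZero : ℕ → ℕ
isZero zero    = 1
isZero (suc _) = 0

-- number of isolated points: indices i with rᵢ = 0 and (i = n or r_{i+1} = 0)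
isolatedPoints : {n : ℕ} → Vec ℕ n → ℕ
isolatedPoints []           = 0
isolatedPoints (x ∷ [])     = isZero x
isolatedPoints (zero ∷ zero ∷ xs)    = 1 + isolatedPoints (zero ∷ xs)
isolatedPoints (zero ∷ suc y ∷ xs)   = isolatedPoints (suc y ∷ xs)
isolatedPoints (suc x ∷ y ∷ xs)      = isolatedPoints (y ∷ xs)

SRk : (n k : ℕ) → Vec ℕ n → Set
SRk n k r = IsSR r × isolatedPoints r ≡ k

-- |{x : A | P x}| = |{y : B | Q y}| expressed as an explicit bijection
-- between the two subsets (maps in both directions, mutually inverse on them).
SubsetBij : {A B : Set} → (A → Set) → (B → Set) → Set
SubsetBij {A} {B} P Q =
  Σ (A → B) λ f → Σ (B → A) λ g →
    ((a : A) → P a → Q (f a)) ×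
    ((b : B) → Q b → P (g b)) ×
    ((a : A) → P a → g (f a) ≡ a) ×
    ((b : B) → Q b → f (g b) ≡ b)

module Submission where

-- Write m_i = min(π_i, …, π_n) for the suffix minima of π (0-indexed throughout). The map
-- π ↦ r with r_i = i − m_i lands in SR: m is weakly increasing, and m_i ≤ i because the i + 1
-- values 0, …, i cannot all sit in the first i positions. For 321-avoiding π, i is a fixed point
-- exactly when m_i ≥ i and m_{i+1} ≥ i + 1, i.e. when r_i = r_{i+1} = 0, so fixed points become
-- isolated points. A 321-avoiding permutation is determined by its suffix minima, which gives
-- injectivity. Conversely π is rebuilt from r right to left: position o receives its target
-- minimum o − r_o when this drops below the next target, and otherwise the largest value not used
-- yet, which keeps the non-minima increasing and the result 321-avoiding.

open import Defs
open import Data.Nat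
  using (ℕ; zero; suc; _+_; _∸_; _≤_; _<_; _⊓_; z≤n; s≤s; s≤s⁻¹; z<s; _<?_; _≤?_)
open import Data.Nat.Properties
open import Data.Nat.DivMod using (_mod_; m<n⇒m%n≡m)
open import Data.Fin using (Fin; toℕ; fromℕ<; punchOut) renaming (zero to fz; suc to fs)
import Data.Fin as F
import Data.Fin.Properties as FP
open import Data.Vec using (Vec; []; _∷_; lookup; map)
open import Data.Vec.Properties using (∷-injective)
open import Data.List using (length; filter; tabulate)
open import Data.Bool using (Bool; true; false; if_then_else_)
open import Data.Product using (_×_; _,_; proj₁; proj₂; ∃-syntax)
open import Data.Sum using (inj₁; inj₂)
open import Data.Unit using (tt)
open import Data.Empty using (⊥; ⊥-elim)
open import Function using (_∘_; _⇔_; mk⇔; Equivalence)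
open import Function.Definitions using (Injective)
open import Relation.Nullary using (¬_; Dec; yes; no; does; contradiction)
open import Relation.Nullary.Decidable using (_×-dec_; ¬?; does-⇔; decidable-stable)
open import Relation.Binary.PropositionalEquality
open import Relation.Binary.Definitions using (tri<; tri≈; tri>)

variable
  k n : ℕ

infixl 9 _!_

-- Out-of-range indices read 0.
_!_ : Vec ℕ n → ℕ → ℕ
[]       ! _     = 0
(x ∷ xs) ! zero  = x
(x ∷ xs) ! suc i = xs ! i

!-≥length : (v : Vec ℕ n) {i : ℕ} → n ≤ i → v ! i ≡ 0
!-≥length []      _       = refl
!-≥length (x ∷ v) (s≤s p) = !-≥length v p

!-extensional : (u w : Vec ℕ n) → (∀ {i} → i < n → u ! i ≡ w ! i) → u ≡ w
!-extensional []      []      _ = refl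
!-extensional (x ∷ u) (y ∷ w) e = cong₂ _∷_ (e z<s) (!-extensional u w (e ∘ s≤s))

tabulateℕ : (n : ℕ) → (ℕ → ℕ) → Vec ℕ n
tabulateℕ zero    h = []
tabulateℕ (suc n) h = h 0 ∷ tabulateℕ n (h ∘ suc)

tabulateℕ-! : ∀ n (h : ℕ → ℕ) {i} → i < n → tabulateℕ n h ! i ≡ h i
tabulateℕ-! (suc n) h {zero}  _       = refl
tabulateℕ-! (suc n) h {suc i} (s≤s p) = tabulateℕ-! n (h ∘ suc) p

map-toℕ-! : (π : Vec (Fin k) n) (i : Fin n) → map toℕ π ! toℕ i ≡ toℕ (lookup π i)
map-toℕ-! (x ∷ π) fz     = refl
map-toℕ-! (x ∷ π) (fs i) = map-toℕ-! π i

map-toℕ-!-fromℕ< : (π : Vec (Fin k) n) {j : ℕ} (p : j < n) →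
                   map toℕ π ! j ≡ toℕ (lookup π (fromℕ< p))
map-toℕ-!-fromℕ< π p = trans (cong (map toℕ π !_) (sym (FP.toℕ-fromℕ< p))) (map-toℕ-! π (fromℕ< p))

map-toℕ-injective : (u w : Vec (Fin k) n) → map toℕ u ≡ map toℕ w → u ≡ w
map-toℕ-injective []      []      _ = refl
map-toℕ-injective (x ∷ u) (y ∷ w) e =
  cong₂ _∷_ (FP.toℕ-injective (proj₁ (∷-injective e))) (map-toℕ-injective u w (proj₂ (∷-injective e)))

minHead : ℕ → Vec ℕ n → ℕ
minHead x []      = x
minHead x (y ∷ _) = x ⊓ y

suffixMin : Vec ℕ n → Vec ℕ n
suffixMin []       = []
suffixMin (x ∷ xs) = minHead x (suffixMin xs) ∷ suffixMin xs

suffixMin-≤ : (v : Vec ℕ n) {i j : ℕ} → i ≤ j → j < n → suffixMin v ! i ≤ v ! j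
suffixMin-≤ (x ∷ [])    {zero}  {zero}  _       _       = ≤-refl
suffixMin-≤ (x ∷ y ∷ v) {zero}  {zero}  _       _       = m⊓n≤m x _
suffixMin-≤ (x ∷ [])    {zero}  {suc j} _       (s≤s ())
suffixMin-≤ (x ∷ y ∷ v) {zero}  {suc j} _       (s≤s q) =
  ≤-trans (m⊓n≤n x _) (suffixMin-≤ (y ∷ v) z≤n q)
suffixMin-≤ (x ∷ v)     {suc i} {suc j} (s≤s p) (s≤s q) = suffixMin-≤ v p q

suffixMin-attained : (v : Vec ℕ n) {i : ℕ} → i < n →
                     ∃[ j ] i ≤ j × j < n × v ! j ≡ suffixMin v ! i
suffixMin-attained (x ∷ []) {zero} _ = 0 , z≤n , z<s , refl
suffixMin-attained (x ∷ y ∷ v) {zero} _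
  with ⊓-sel x (suffixMin (y ∷ v) ! 0) | suffixMin-attained (y ∷ v) z<s
... | inj₁ x-min | _                 = 0 , z≤n , z<s , sym x-min
... | inj₂ y-min | j , _ , j<n , vj≡ = suc j , z≤n , s≤s j<n , trans vj≡ (sym y-min)
suffixMin-attained (x ∷ v) {suc i} (s≤s p) with suffixMin-attained v p
... | j , i≤j , j<n , vj≡ = suc j , s≤s i≤j , s≤s j<n , vj≡

suffixMin-glb : (v : Vec ℕ n) {b i : ℕ} → i < n → (∀ {j} → i ≤ j → j < n → b ≤ v ! j) →
                b ≤ suffixMin v ! i
suffixMin-glb v p lower with suffixMin-attained v p
... | j , i≤j , j<n , vj≡ = subst (_ ≤_) vj≡ (lower i≤j j<n)

suffixMin-suc : (v : Vec ℕ n) {i : ℕ} → suc i < n → suffixMin v ! i ≡ v ! i ⊓ suffixMin v ! suc i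
suffixMin-suc (x ∷ y ∷ v) {zero}  _       = refl
suffixMin-suc (x ∷ v)     {suc i} (s≤s p) = suffixMin-suc v p

suffixMin-mono : (v : Vec ℕ n) {i : ℕ} → suc i < n → suffixMin v ! i ≤ suffixMin v ! suc i
suffixMin-mono v p = ≤-trans (≤-reflexive (suffixMin-suc v p)) (m⊓n≤n _ _)

suffixMin-last : (v : Vec ℕ n) {i : ℕ} → suc i ≡ n → suffixMin v ! i ≡ v ! i
suffixMin-last (x ∷ [])    {zero}  refl = refl
suffixMin-last (x ∷ y ∷ v) {suc i} e    = suffixMin-last (y ∷ v) (suc-injective e)

suffixMin-new : (y : ℕ) (T : Vec ℕ k) → (0 < k → y ≤ suffixMin T ! 0) → suffixMin (y ∷ T) ! 0 ≡ y
suffixMin-new y []      _ = refl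
suffixMin-new y (t ∷ T) h = m≤n⇒m⊓n≡m (h z<s)

suffixMin-old : (y : ℕ) (T : Vec ℕ k) → 0 < k → suffixMin T ! 0 ≤ y →
                suffixMin (y ∷ T) ! 0 ≡ suffixMin T ! 0
suffixMin-old y (t ∷ T) _ h = m≥n⇒m⊓n≡n h

injectiveRel⇒≤ : ∀ a b (R : ℕ → ℕ → Set) →
                 (∀ {x} → x < a → ∃[ y ] y < b × R x y) →
                 (∀ {x x′ y} → x < a → x′ < a → R x y → R x′ y → x ≡ x′) → a ≤ b
injectiveRel⇒≤ a b R total injective = FP.injective⇒≤ {f = h} h-injective
  where
  image : (i : Fin a) → ∃[ y ] y < b × R (toℕ i) y
  image i = total (FP.toℕ<n i)
  h : Fin a → Fin b
  h i = fromℕ< (proj₁ (proj₂ (image i)))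
  h-injective : Injective _≡_ _≡_ h
  h-injective {i} {j} e = FP.toℕ-injective (injective (FP.toℕ<n i) (FP.toℕ<n j) Ri Rj)
    where
    Ri : R (toℕ i) (proj₁ (image i))
    Ri = proj₂ (proj₂ (image i))
    same-image : proj₁ (image i) ≡ proj₁ (image j)
    same-image = trans (sym (FP.toℕ-fromℕ< _)) (trans (cong toℕ e) (FP.toℕ-fromℕ< _))
    Rj : R (toℕ j) (proj₁ (image i))
    Rj = subst (R (toℕ j)) (sym same-image) (proj₂ (proj₂ (image j)))

injectiveOn⇒≤ : ∀ a b (h : ℕ → ℕ) → (∀ {x} → x < a → h x < b) →
                (∀ {x y} → x < a → y < a → h x ≡ h y → x ≡ y) → a ≤ b
injectiveOn⇒≤ a b h bounded injective =
  injectiveRel⇒≤ a b (λ x y → h x ≡ y) (λ p → h _ , bounded p , refl)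
    (λ p q hx≡y hx′≡y → injective p q (trans hx≡y (sym hx′≡y)))

injective⇒surjective : (h : Fin n → Fin n) → Injective _≡_ _≡_ h → ∀ y → ∃[ i ] h i ≡ y
injective⇒surjective {zero}  h _ ()
injective⇒surjective {suc n} h h-injective y with FP.any? (λ i → h i F.≟ y)
... | yes hit = hit
... | no miss = contradiction (FP.injective⇒≤ {f = h′} h′-injective) 1+n≰n
  where
  y≢h : ∀ i → y ≢ h i
  y≢h i e = miss (i , sym e)
  h′ : Fin (suc n) → Fin n
  h′ i = punchOut (y≢h i)
  h′-injective : Injective _≡_ _≡_ h′
  h′-injective {i} {j} e = h-injective (FP.punchOut-injective (y≢h i) (y≢h j) e)

count : (ℕ → Bool) → ℕ → ℕ
count p zero    = 0
count p (suc n) = (if p 0 then 1 else 0) + count (p ∘ suc) n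

count-cong : ∀ n (p q : ℕ → Bool) → (∀ {i} → i < n → p i ≡ q i) → count p n ≡ count q n
count-cong zero    p q e = refl
count-cong (suc n) p q e =
  cong₂ _+_ (cong (λ b → if b then 1 else 0) (e z<s)) (count-cong n (p ∘ suc) (q ∘ suc) (e ∘ s≤s))

length-filter-tabulate : ∀ {A : Set} {P : A → Set} n (g : Fin n → A) (P? : ∀ a → Dec (P a))
                         (p : ℕ → Bool) → (∀ i → p (toℕ i) ≡ does (P? (g i))) →
                         length (filter P? (tabulate g)) ≡ count p n
length-filter-tabulate zero    g P? p agree = refl
length-filter-tabulate (suc n) g P? p agree with does (P? (g fz)) | agree fz
... | true  | p0≡true  rewrite p0≡true  =
  cong suc (length-filter-tabulate n (g ∘ fs) P? (p ∘ suc) (agree ∘ fs))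
... | false | p0≡false rewrite p0≡false =
  length-filter-tabulate n (g ∘ fs) P? (p ∘ suc) (agree ∘ fs)

fixed? : Vec ℕ n → ℕ → Bool
fixed? v i = does (v ! i ≟ i)

-- At the last index r ! suc i reads 0, which encodes the clause i = n of an isolated point.
isolated? : Vec ℕ n → ℕ → Bool
isolated? r i = does ((r ! i ≟ 0) ×-dec (r ! suc i ≟ 0))

isolatedPoints-count : (r : Vec ℕ n) → isolatedPoints r ≡ count (isolated? r) n
isolatedPoints-count []                 = refl
isolatedPoints-count (zero ∷ [])        = refl
isolatedPoints-count (suc x ∷ [])       = refl
isolatedPoints-count (zero ∷ zero ∷ r)  = cong suc (isolatedPoints-count (zero ∷ r))
isolatedPoints-count (zero ∷ suc y ∷ r) = isolatedPoints-count (suc y ∷ r)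
isolatedPoints-count (suc x ∷ y ∷ r)    = isolatedPoints-count (y ∷ r)

fixedPoints-count : (π : Vec (Fin n) n) → fixedPoints π ≡ count (fixed? (map toℕ π)) n
fixedPoints-count {n} π = length-filter-tabulate n (λ i → i) (λ i → lookup π i F.≟ i) _ agree
  where
  agree : ∀ i → fixed? (map toℕ π) (toℕ i) ≡ does (lookup π i F.≟ i)
  agree i rewrite map-toℕ-! π i =
    does-⇔ (mk⇔ FP.toℕ-injective (cong toℕ)) (toℕ (lookup π i) ≟ toℕ i) (lookup π i F.≟ i)

Distinct : Vec ℕ n → Set
Distinct {n} v = ∀ {j l} → j < n → l < n → v ! j ≡ v ! l → j ≡ l

record IsPermWord (v : Vec ℕ n) : Set where
  field
    distinct : Distinct v
    bounded  : ∀ {j} → j < n → v ! j < n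
    onto     : ∀ {u} → u < n → ∃[ j ] j < n × v ! j ≡ u

Avoids321ℕ : Vec ℕ n → Set
Avoids321ℕ {n} v = ∀ {a b c} → a < b → b < c → c < n → v ! b < v ! a → v ! c < v ! b → ⊥

isPerm⇔distinct : (π : Vec (Fin n) n) → IsPerm π ⇔ Distinct (map toℕ π)
isPerm⇔distinct {n} π = mk⇔ to from
  where
  to : IsPerm π → Distinct (map toℕ π)
  to perm {j} {l} p q e = begin
    j                  ≡⟨ FP.toℕ-fromℕ< p ⟨
    toℕ (fromℕ< p)     ≡⟨ cong toℕ (perm (FP.toℕ-injective πj≡πl)) ⟩
    toℕ (fromℕ< q)     ≡⟨ FP.toℕ-fromℕ< q ⟩
    l                  ∎
    where
    open ≡-Reasoning
    πj≡πl : toℕ (lookup π (fromℕ< p)) ≡ toℕ (lookup π (fromℕ< q))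
    πj≡πl = trans (sym (map-toℕ-!-fromℕ< π p)) (trans e (map-toℕ-!-fromℕ< π q))
  from : Distinct (map toℕ π) → IsPerm π
  from distinct {i} {j} e = FP.toℕ-injective (distinct (FP.toℕ<n i) (FP.toℕ<n j)
    (trans (map-toℕ-! π i) (trans (cong toℕ e) (sym (map-toℕ-! π j)))))

isPermWord : (π : Vec (Fin n) n) → IsPerm π → IsPermWord (map toℕ π)
isPermWord {n} π perm = record
  { distinct = Equivalence.to (isPerm⇔distinct π) perm
  ; bounded  = λ p → subst (_< n) (sym (map-toℕ-!-fromℕ< π p)) (FP.toℕ<n _)
  ; onto     = onto
  }
  where
  onto : ∀ {u} → u < n → ∃[ j ] j < n × map toℕ π ! j ≡ u
  onto p with injective⇒surjective (lookup π) perm (fromℕ< p)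
  ... | i , πi≡u =
    toℕ i , FP.toℕ<n i , trans (map-toℕ-! π i) (trans (cong toℕ πi≡u) (FP.toℕ-fromℕ< p))

avoids321⇔ : (π : Vec (Fin n) n) → Avoids321 π ⇔ Avoids321ℕ (map toℕ π)
avoids321⇔ {n} π = mk⇔ to from
  where
  at : ∀ {j} (p : j < n) → map toℕ π ! j ≡ toℕ (lookup π (fromℕ< p))
  at = map-toℕ-!-fromℕ< π
  idx : ∀ {j} (p : j < n) → toℕ (fromℕ< p) ≡ j
  idx p = FP.toℕ-fromℕ< p
  to : Avoids321 π → Avoids321ℕ (map toℕ π)
  to avoids {a} {b} {c} a<b b<c c<n πb<πa πc<πb =
    avoids (fromℕ< a<n) (fromℕ< b<n) (fromℕ< c<n)
      (subst₂ _<_ (sym (idx a<n)) (sym (idx b<n)) a<b)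
      (subst₂ _<_ (sym (idx b<n)) (sym (idx c<n)) b<c)
      (subst₂ _<_ (at b<n) (at a<n) πb<πa , subst₂ _<_ (at c<n) (at b<n) πc<πb)
    where
    b<n : b < n
    b<n = <-trans b<c c<n
    a<n : a < n
    a<n = <-trans a<b b<n
  from : Avoids321ℕ (map toℕ π) → Avoids321 π
  from avoids i j l i<j j<l (πj<πi , πl<πj) =
    avoids i<j j<l (FP.toℕ<n l)
      (subst₂ _<_ (sym (map-toℕ-! π j)) (sym (map-toℕ-! π i)) πj<πi)
      (subst₂ _<_ (sym (map-toℕ-! π l)) (sym (map-toℕ-! π j)) πl<πj)

prefix-below⇒rest-above : {v : Vec ℕ n} → Distinct v → ∀ {i} → (∀ {l} → l < i → v ! l < i) →
                          ∀ {j} → i ≤ j → j < n → i ≤ v ! j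
prefix-below⇒rest-above {n} {v} distinct {i} prefix {j} i≤j j<n with i ≤? v ! j
... | yes i≤vj = i≤vj
... | no i≰vj = contradiction (injectiveOn⇒≤ (suc i) i (λ x → v ! pos x) below injective) 1+n≰n
  where
  pos : ℕ → ℕ
  pos x with x <? i
  ... | yes _ = x
  ... | no  _ = j
  pos<n : ∀ {x} → x < suc i → pos x < n
  pos<n {x} _ with x <? i
  ... | yes x<i = <-≤-trans x<i (≤-trans i≤j (<⇒≤ j<n))
  ... | no  _   = j<n
  below : ∀ {x} → x < suc i → v ! pos x < i
  below {x} _ with x <? i
  ... | yes x<i = prefix x<i
  ... | no  _   = ≰⇒> i≰vj
  pos-injective : ∀ {x y} → x < suc i → y < suc i → pos x ≡ pos y → x ≡ y
  pos-injective {x} {y} x≤i y≤i e with x <? i | y <? i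
  ... | yes _   | yes _   = e
  ... | yes x<i | no  _   = contradiction i≤j (<⇒≱ (subst (_< i) e x<i))
  ... | no  _   | yes y<i = contradiction i≤j (<⇒≱ (subst (_< i) (sym e) y<i))
  ... | no  x≮i | no  y≮i =
    trans (≤-antisym (s≤s⁻¹ x≤i) (≮⇒≥ x≮i)) (sym (≤-antisym (s≤s⁻¹ y≤i) (≮⇒≥ y≮i)))
  injective : ∀ {x y} → x < suc i → y < suc i → v ! pos x ≡ v ! pos y → x ≡ y
  injective p q e = pos-injective p q (distinct (pos<n p) (pos<n q) e)

module PermWord {n} {v : Vec ℕ n} (perm : IsPermWord v) where
  open IsPermWord perm

  -- Otherwise the i + 1 values 0, …, i would all sit among the first i positions.
  not-all-above : ∀ {i} → i < n → ¬ (∀ {j} → i ≤ j → j < n → i < v ! j)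
  not-all-above {i} i<n above =
    contradiction (injectiveRel⇒≤ (suc i) i (λ u j → v ! j ≡ u) position unique) 1+n≰n
    where
    position : ∀ {u} → u < suc i → ∃[ j ] j < i × v ! j ≡ u
    position {u} u≤i with onto (≤-trans u≤i i<n)
    ... | j , j<n , vj≡u with j <? i
    ...   | yes j<i = j , j<i , vj≡u
    ...   | no  j≮i = contradiction (subst (i <_) vj≡u (above (≮⇒≥ j≮i) j<n)) (≤⇒≯ (s≤s⁻¹ u≤i))
    unique : ∀ {u u′ j} → u < suc i → u′ < suc i → v ! j ≡ u → v ! j ≡ u′ → u ≡ u′
    unique _ _ vj≡u vj≡u′ = trans (sym vj≡u) vj≡u′

  suffixMin≤index : ∀ {i} → i < n → suffixMin v ! i ≤ i
  suffixMin≤index {i} i<n with suffixMin v ! i ≤? i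
  ... | yes m≤i = m≤i
  ... | no  m≰i = ⊥-elim (not-all-above i<n λ i≤j j<n → <-≤-trans (≰⇒> m≰i) (suffixMin-≤ v i≤j j<n))

  -- If an earlier entry exceeds i, a later entry below i completes a 321 with it;
  -- otherwise the first i entries use up all values below i.
  fixed⇒later-above : Avoids321ℕ v → ∀ {i j} → i < n → v ! i ≡ i → i < j → j < n → i < v ! j
  fixed⇒later-above avoids {i} {j} i<n vi≡i i<j j<n =
    ≤∧≢⇒< i≤vj (λ i≡vj → <-irrefl (distinct i<n j<n (trans vi≡i i≡vj)) i<j)
    where
    i≤vj : i ≤ v ! j
    i≤vj with anyUpTo? (λ l → i <? v ! l) i
    ... | yes (l , l<i , i<vl) = ≮⇒≥ λ vj<i →
      avoids l<i i<j j<n (subst (_< v ! l) (sym vi≡i) i<vl) (subst (v ! j <_) (sym vi≡i) vj<i)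
    ... | no none = prefix-below⇒rest-above {v = v} distinct prefix-below (<⇒≤ i<j) j<n
      where
      prefix-below : ∀ {l} → l < i → v ! l < i
      prefix-below {l} l<i = ≤∧≢⇒< (≮⇒≥ (λ i<vl → none (l , l<i , i<vl)))
        (λ vl≡i → <-irrefl (distinct (<-trans l<i i<n) i<n (trans vl≡i (sym vi≡i))) l<i)

  fixed⇔suffixMin-bounds : Avoids321ℕ v → ∀ {i} → i < n →
    v ! i ≡ i ⇔ (i ≤ suffixMin v ! i × (suc i < n → suc i ≤ suffixMin v ! suc i))
  fixed⇔suffixMin-bounds avoids {i} i<n = mk⇔ to from
    where
    to : v ! i ≡ i → i ≤ suffixMin v ! i × (suc i < n → suc i ≤ suffixMin v ! suc i)
    to vi≡i = suffixMin-glb v i<n at-or-after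
            , λ si<n → suffixMin-glb v si<n (fixed⇒later-above avoids i<n vi≡i)
      where
      at-or-after : ∀ {j} → i ≤ j → j < n → i ≤ v ! j
      at-or-after i≤j j<n with m≤n⇒m<n∨m≡n i≤j
      ... | inj₁ i<j  = <⇒≤ (fixed⇒later-above avoids i<n vi≡i i<j j<n)
      ... | inj₂ refl = ≤-reflexive (sym vi≡i)
    from : i ≤ suffixMin v ! i × (suc i < n → suc i ≤ suffixMin v ! suc i) → v ! i ≡ i
    from (i≤mi , later) with v ! i ≟ i
    ... | yes vi≡i = vi≡i
    ... | no  vi≢i = ⊥-elim (not-all-above i<n all-above)
      where
      all-above : ∀ {j} → i ≤ j → j < n → i < v ! j
      all-above i≤j j<n with m≤n⇒m<n∨m≡n i≤j
      ... | inj₁ i<j  = ≤-trans (later (≤-<-trans i<j j<n)) (suffixMin-≤ v i<j j<n)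
      ... | inj₂ refl = ≤∧≢⇒< (≤-trans i≤mi (suffixMin-≤ v ≤-refl j<n)) (vi≢i ∘ sym)

toSR : Vec ℕ n → Vec ℕ n
toSR {n} v = tabulateℕ n (λ i → i ∸ suffixMin v ! i)

toSR-! : (v : Vec ℕ n) {i : ℕ} → i < n → toSR v ! i ≡ i ∸ suffixMin v ! i
toSR-! {n} v = tabulateℕ-! n _

suc-∸-≤ : ∀ m n → suc m ∸ n ≤ suc (m ∸ n)
suc-∸-≤ m       zero    = ≤-refl
suc-∸-≤ zero    (suc n) = ≤-trans (≤-reflexive (0∸n≡0 n)) z≤n
suc-∸-≤ (suc m) (suc n) = suc-∸-≤ m n

tabulateℕ-steps : ∀ k (h : ℕ → ℕ) → (∀ {i} → suc i < suc k → h (suc i) ≤ suc (h i)) →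
                  Steps (tabulateℕ (suc k) h)
tabulateℕ-steps zero    h step = steps[ h 0 ]
tabulateℕ-steps (suc k) h step = steps∷ (step (s≤s z<s)) (tabulateℕ-steps k (h ∘ suc) (step ∘ s≤s))

toSR-isSR : (v : Vec ℕ n) → IsSR (toSR v)
toSR-isSR {zero}  [] = tt
toSR-isSR {suc k} v  = 0∸n≡0 (suffixMin v ! 0) , tabulateℕ-steps k _ step
  where
  step : ∀ {i} → suc i < suc k → suc i ∸ suffixMin v ! suc i ≤ suc (i ∸ suffixMin v ! i)
  step {i} p = ≤-trans (∸-monoʳ-≤ (suc i) (suffixMin-mono v p)) (suc-∸-≤ i (suffixMin v ! i))

toSR-!≡0⇔ : (v : Vec ℕ n) (i : ℕ) → toSR v ! i ≡ 0 ⇔ (i < n → i ≤ suffixMin v ! i)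
toSR-!≡0⇔ {n} v i = mk⇔ to from
  where
  to : toSR v ! i ≡ 0 → i < n → i ≤ suffixMin v ! i
  to ri≡0 i<n = m∸n≡0⇒m≤n (trans (sym (toSR-! v i<n)) ri≡0)
  from : (i < n → i ≤ suffixMin v ! i) → toSR v ! i ≡ 0
  from bound with i <? n
  ... | yes i<n = trans (toSR-! v i<n) (m≤n⇒m∸n≡0 (bound i<n))
  ... | no  i≮n = !-≥length (toSR v) (≮⇒≥ i≮n)

isolatedPoints-toSR : {v : Vec ℕ n} → IsPermWord v → Avoids321ℕ v →
                      isolatedPoints (toSR v) ≡ count (fixed? v) n
isolatedPoints-toSR {n} {v} perm avoids =
  trans (isolatedPoints-count (toSR v)) (count-cong n (isolated? (toSR v)) (fixed? v) agree)
  where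
  open Equivalence
  isolated⇔fixed : ∀ {i} → i < n → (toSR v ! i ≡ 0 × toSR v ! suc i ≡ 0) ⇔ v ! i ≡ i
  isolated⇔fixed {i} i<n = mk⇔
    (λ (ri≡0 , rsi≡0) →
      from fixed⇔ (to (toSR-!≡0⇔ v i) ri≡0 i<n , to (toSR-!≡0⇔ v (suc i)) rsi≡0))
    (λ vi≡i → let (i≤mi , next) = to fixed⇔ vi≡i in
              from (toSR-!≡0⇔ v i) (λ _ → i≤mi) , from (toSR-!≡0⇔ v (suc i)) next)
    where
    fixed⇔ : v ! i ≡ i ⇔ (i ≤ suffixMin v ! i × (suc i < n → suc i ≤ suffixMin v ! suc i))
    fixed⇔ = PermWord.fixed⇔suffixMin-bounds perm avoids i<n
  agree : ∀ {i} → i < n → isolated? (toSR v) i ≡ fixed? v i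
  agree {i} i<n = does-⇔ (isolated⇔fixed i<n) ((toSR v ! i ≟ 0) ×-dec (toSR v ! suc i ≟ 0)) (v ! i ≟ i)

module _ {n} {v w : Vec ℕ n} (perm-v : IsPermWord v) (avoids-v : Avoids321ℕ v) (perm-w : IsPermWord w)
         (same-min : ∀ {i} → i < n → suffixMin v ! i ≡ suffixMin w ! i) where
  open IsPermWord

  agreeAbove⇒≮ : ∀ {i} → i < n → (∀ {j} → i < j → j < n → v ! j ≡ w ! j) → ¬ (v ! i < w ! i)
  agreeAbove⇒≮ {i} i<n agree vi<wi with suc i <? n
  ... | no last = <-irrefl (begin
          v ! i            ≡⟨ suffixMin-last v (≤-antisym i<n (≮⇒≥ last)) ⟨
          suffixMin v ! i  ≡⟨ same-min i<n ⟩
          suffixMin w ! i  ≡⟨ suffixMin-last w (≤-antisym i<n (≮⇒≥ last)) ⟩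
          w ! i            ∎) vi<wi
    where open ≡-Reasoning
  ... | yes si<n with v ! i <? suffixMin v ! suc i
  ...   | yes new-min = <-irrefl (begin
          v ! i                        ≡⟨ m≤n⇒m⊓n≡m (<⇒≤ new-min) ⟨
          v ! i ⊓ suffixMin v ! suc i  ≡⟨ suffixMin-suc v si<n ⟨
          suffixMin v ! i              ≡⟨ same-min i<n ⟩
          suffixMin w ! i              ≡⟨ suffixMin-suc w si<n ⟩
          w ! i ⊓ suffixMin w ! suc i  ≡⟨ cong (w ! i ⊓_) (same-min si<n) ⟨
          w ! i ⊓ suffixMin v ! suc i  ∎) (⊓-glb vi<wi new-min)
    where open ≡-Reasoning
  -- v ! i is not a suffix minimum, so some later v ! j lies below it; w ! i occurs in v at some l,
  -- which can be neither i, nor after i (where v and w agree), nor before i (321 at l, i, j).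
  ...   | no  old-min with suffixMin-attained v si<n | onto perm-v (bounded perm-w i<n)
  ...     | j , i<j , j<n , vj≡min | l , l<n , vl≡wi with <-cmp l i
  ...       | tri< l<i _ _ = avoids-v l<i i<j j<n (subst (v ! i <_) (sym vl≡wi) vi<wi) vj<vi
    where
    vj<vi : v ! j < v ! i
    vj<vi = ≤∧≢⇒< (subst (_≤ v ! i) (sym vj≡min) (≮⇒≥ old-min))
                  (λ vj≡vi → <-irrefl (distinct perm-v i<n j<n (sym vj≡vi)) i<j)
  ...       | tri≈ _ refl _ = <-irrefl vl≡wi vi<wi
  ...       | tri> _ _ i<l = <-irrefl (distinct perm-w i<n l<n (trans (sym vl≡wi) (agree i<l l<n))) i<l

suffixMin-injective : {v w : Vec ℕ n} → IsPermWord v → Avoids321ℕ v → IsPermWord w → Avoids321ℕ w →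
                      (∀ {i} → i < n → suffixMin v ! i ≡ suffixMin w ! i) → v ≡ w
suffixMin-injective {n} {v} {w} perm-v avoids-v perm-w avoids-w same-min =
  !-extensional v w (agreeFrom n (+-identityʳ n) z≤n)
  where
  agreeFrom : ∀ d {i} → d + i ≡ n → ∀ {j} → i ≤ j → j < n → v ! j ≡ w ! j
  agreeFrom zero    refl i≤j j<n = contradiction i≤j (<⇒≱ j<n)
  agreeFrom (suc d) {i} e {j} i≤j j<n with m≤n⇒m<n∨m≡n i≤j
  ... | inj₁ i<j  = agreeFrom d (trans (+-suc d i) e) i<j j<n
  ... | inj₂ refl = ≤-antisym
    (≮⇒≥ (agreeAbove⇒≮ perm-w avoids-w perm-v (sym ∘ same-min) i<n λ p q → sym (agreeAbove p q)))
    (≮⇒≥ (agreeAbove⇒≮ perm-v avoids-v perm-w same-min i<n agreeAbove))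
    where
    i<n : i < n
    i<n = subst (i <_) e (s≤s (m≤n+m i d))
    agreeAbove : ∀ {k} → i < k → k < n → v ! k ≡ w ! k
    agreeAbove = agreeFrom d (trans (+-suc d i) e)

toSR-injective : {v w : Vec ℕ n} → IsPermWord v → Avoids321ℕ v → IsPermWord w → Avoids321ℕ w →
                 toSR v ≡ toSR w → v ≡ w
toSR-injective {n} {v} {w} perm-v avoids-v perm-w avoids-w e =
  suffixMin-injective perm-v avoids-v perm-w avoids-w same-min
  where
  same-min : ∀ {i} → i < n → suffixMin v ! i ≡ suffixMin w ! i
  same-min {i} i<n = ∸-cancelˡ-≡ (PermWord.suffixMin≤index perm-v i<n) (PermWord.suffixMin≤index perm-w i<n)
    (trans (sym (toSR-! v i<n)) (trans (cong (_! i) e) (toSR-! w i<n)))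

_occursIn_ : ℕ → Vec ℕ k → Set
_occursIn_ {k} u T = ∃[ j ] j < k × T ! j ≡ u

occursIn? : (u : ℕ) (T : Vec ℕ k) → Dec (u occursIn T)
occursIn? {k} u T = anyUpTo? (λ j → T ! j ≟ u) k

occursIn-∷ : ∀ {u y} {T : Vec ℕ k} → u occursIn T → u occursIn (y ∷ T)
occursIn-∷ (j , j<k , Tj≡u) = suc j , s≤s j<k , Tj≡u

maxMissing : ℕ → Vec ℕ k → ℕ
maxMissing zero    T = 0
maxMissing (suc M) T with occursIn? M T
... | yes _ = maxMissing M T
... | no  _ = M

maxMissing-missing : ∀ M (T : Vec ℕ k) {u} → u < M → ¬ u occursIn T →
                     maxMissing M T < M × ¬ maxMissing M T occursIn T
maxMissing-missing (suc M) T {u} u≤M u∉T with occursIn? M T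
... | no  M∉T = ≤-refl , M∉T
... | yes M∈T =
  let (max<M , max∉T) = maxMissing-missing M T u<M u∉T in m<n⇒m<1+n max<M , max∉T
  where
  u<M : u < M
  u<M = ≤∧≢⇒< (s≤s⁻¹ u≤M) (λ { refl → u∉T M∈T })

maxMissing-greatest : ∀ M (T : Vec ℕ k) {u} → u < M → ¬ u occursIn T → u ≤ maxMissing M T
maxMissing-greatest (suc M) T {u} u≤M u∉T with occursIn? M T
... | no  _   = s≤s⁻¹ u≤M
... | yes M∈T = maxMissing-greatest M T (≤∧≢⇒< (s≤s⁻¹ u≤M) (λ { refl → u∉T M∈T })) u∉T

<∸⇒+< : ∀ t {x M} → x < M ∸ t → t + x < M
<∸⇒+< zero    {M = M}     x<M   = x<M
<∸⇒+< (suc t) {M = suc M} x<M∸t = s≤s (<∸⇒+< t x<M∸t)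

missing-from : (T : Vec ℕ k) {t M : ℕ} → k < M ∸ t → ∃[ u ] t ≤ u × u < M × ¬ u occursIn T
missing-from {k} T {t} {M} k<M∸t with anyUpTo? (λ u → (t ≤? u) ×-dec ¬? (occursIn? u T)) M
... | yes (u , u<M , t≤u , u∉T) = u , t≤u , u<M , u∉T
... | no none =
  contradiction (injectiveRel⇒≤ (M ∸ t) k (λ x j → T ! j ≡ t + x) position unique) (<⇒≱ k<M∸t)
  where
  position : ∀ {x} → x < M ∸ t → ∃[ j ] j < k × T ! j ≡ t + x
  position {x} x<M∸t = decidable-stable (occursIn? (t + x) T)
    (λ t+x∉T → none (t + x , <∸⇒+< t x<M∸t , m≤m+n t x , t+x∉T))
  unique : ∀ {x x′ j} → x < M ∸ t → x′ < M ∸ t → T ! j ≡ t + x → T ! j ≡ t + x′ → x ≡ x′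
  unique _ _ Tj≡t+x Tj≡t+x′ = +-cancelˡ-≡ t _ _ (trans (sym Tj≡t+x) Tj≡t+x′)

maxMissing-above : (T : Vec ℕ k) {t M : ℕ} → t occursIn T → k < M ∸ t →
                   t < maxMissing M T × maxMissing M T < M × ¬ maxMissing M T occursIn T
maxMissing-above T {t} {M} t∈T k<M∸t with missing-from T k<M∸t
... | u , t≤u , u<M , u∉T =
  <-≤-trans t<u (maxMissing-greatest M T u<M u∉T) , maxMissing-missing M T u<M u∉T
  where
  t<u : t < u
  t<u = ≤∧≢⇒< t≤u (λ t≡u → u∉T (subst (_occursIn T) t≡u t∈T))

∷-distinct : ∀ {y} {T : Vec ℕ k} → ¬ y occursIn T → Distinct T → Distinct (y ∷ T)
∷-distinct y∉T distinct {zero}  {zero}  _       _       _ = refl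
∷-distinct y∉T distinct {zero}  {suc l} _       (s≤s q) e = ⊥-elim (y∉T (l , q , sym e))
∷-distinct y∉T distinct {suc j} {zero}  (s≤s p) _       e = ⊥-elim (y∉T (j , p , e))
∷-distinct y∉T distinct {suc j} {suc l} (s≤s p) (s≤s q) e = cong suc (distinct p q e)

∷-avoids : ∀ {y} {T : Vec ℕ k} → (∀ {b c} → b < c → c < k → T ! b < y → T ! c < T ! b → ⊥) →
           Avoids321ℕ T → Avoids321ℕ (y ∷ T)
∷-avoids head-ok avoids {zero}  {suc b} {suc c} _       (s≤s b<c) (s≤s c<k) = head-ok b<c c<k
∷-avoids head-ok avoids {suc a} {suc b} {suc c} (s≤s a<b) (s≤s b<c) (s≤s c<k) = avoids a<b b<c c<k

steps-tail : ∀ {x} {xs : Vec ℕ k} → Steps (x ∷ xs) → Steps xs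
steps-tail steps[ x ]    = steps[]
steps-tail (steps∷ _ s) = s

steps-target-mono : ∀ o {x} (xs : Vec ℕ k) → Steps (x ∷ xs) → o ∸ x ≤ suc o ∸ xs ! 0
steps-target-mono o {x} []       _              = ≤-trans (m∸n≤m o x) (n≤1+n o)
steps-target-mono o     (y ∷ xs) (steps∷ y≤1+x _) = ∸-monoʳ-≤ (suc o) y≤1+x

steps-! : {r : Vec ℕ n} → Steps r → ∀ {i} → suc i < n → r ! suc i ≤ suc (r ! i)
steps-! steps[ x ]         (s≤s ())
steps-! (steps∷ y≤1+x _) {zero}  _       = y≤1+x
steps-! (steps∷ _ steps) {suc i} (s≤s p) = steps-! steps p

isSR-steps : (r : Vec ℕ n) → IsSR r → Steps r
isSR-steps []      _           = steps[]
isSR-steps (x ∷ r) (_ , steps) = steps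

isSR-≤index : (r : Vec ℕ n) → IsSR r → ∀ {i} → i < n → r ! i ≤ i
isSR-≤index (x ∷ r) (x≡0 , _)     {zero}  _ = ≤-reflexive x≡0
isSR-≤index (x ∷ r) sr@(_ , steps) {suc i} p =
  ≤-trans (steps-! steps p) (s≤s (isSR-≤index (x ∷ r) sr (<-trans (n<1+n i) p)))

module Reconstruction (N : ℕ) where

  -- o is the position of x in r. For xs = [] the test compares with suc o ∸ 0, so the last entry is
  -- always its own suffix minimum.
  build : ℕ → Vec ℕ k → Vec ℕ k
  build o []       = []
  build o (x ∷ xs) with o ∸ x <? suc o ∸ xs ! 0
  ... | yes _ = o ∸ x ∷ build (suc o) xs
  ... | no  _ = maxMissing N (build (suc o) xs) ∷ build (suc o) xs

  record Invariant {k} (o : ℕ) (xs T : Vec ℕ k) : Set where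
    field
      distinct         : Distinct T
      bounded          : ∀ {j} → j < k → T ! j < N
      avoids           : Avoids321ℕ T
      -- This is what lets the largest missing value be put in front without creating a 321.
      nonMin>missing   : ∀ {j l u} → j < l → l < k → T ! l < T ! j → u < N → ¬ u occursIn T → u < T ! j
      suffixMin-target : ∀ {j} → j < k → suffixMin T ! j ≡ (o + j) ∸ xs ! j

  ∷-invariant : ∀ {o x y} {xs T : Vec ℕ k} → Invariant (suc o) xs T → ¬ y occursIn T → y < N →
                (∀ {b c} → b < c → c < k → T ! b < y → T ! c < T ! b → ⊥) →
                (∀ {l u} → l < k → T ! l < y → u < N → ¬ u occursIn (y ∷ T) → u < y) →
                suffixMin (y ∷ T) ! 0 ≡ o ∸ x → Invariant o (x ∷ xs) (y ∷ T)
  ∷-invariant {k} {o} {x} {y} {xs} {T} inv y∉T y<N head-ok nonMin-head target-head = record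
    { distinct         = ∷-distinct y∉T distinct
    ; bounded          = λ { {zero} _ → y<N ; {suc j} (s≤s p) → bounded p }
    ; avoids           = ∷-avoids head-ok avoids
    ; nonMin>missing   = nonMin>missing′
    ; suffixMin-target = target
    }
    where
    open Invariant inv
    nonMin>missing′ : ∀ {j l u} → j < l → l < suc k → (y ∷ T) ! l < (y ∷ T) ! j → u < N →
                      ¬ u occursIn (y ∷ T) → u < (y ∷ T) ! j
    nonMin>missing′ {zero}  {suc l} _         (s≤s l<k) Tl<y     u<N u∉ = nonMin-head l<k Tl<y u<N u∉
    nonMin>missing′ {suc j} {suc l} (s≤s j<l) (s≤s l<k) Tl<Tj   u<N u∉ =
      nonMin>missing j<l l<k Tl<Tj u<N (u∉ ∘ occursIn-∷)
    target : ∀ {j} → j < suc k → suffixMin (y ∷ T) ! j ≡ (o + j) ∸ (x ∷ xs) ! j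
    target {zero}  _       = trans target-head (cong (_∸ x) (sym (+-identityʳ o)))
    target {suc j} (s≤s p) = trans (suffixMin-target p) (cong (_∸ xs ! j) (sym (+-suc o j)))

  new-min-invariant : ∀ o {x} (xs : Vec ℕ k) → o + suc k ≡ N → o ∸ x < suc o ∸ xs ! 0 →
                      ∀ {T} → Invariant (suc o) xs T → Invariant o (x ∷ xs) (o ∸ x ∷ T)
  new-min-invariant {k} o {x} xs o+1+k≡N new-min {T} inv =
    ∷-invariant inv y∉T y<N head-ok nonMin-head target-head
    where
    open Invariant inv
    next-target : 0 < k → suffixMin T ! 0 ≡ suc o ∸ xs ! 0
    next-target p = trans (suffixMin-target p) (cong (_∸ xs ! 0) (+-identityʳ (suc o)))
    below-all : ∀ {j} → j < k → o ∸ x < T ! j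
    below-all {j} p = <-≤-trans new-min
      (subst (_≤ T ! j) (next-target (≤-<-trans z≤n p)) (suffixMin-≤ T z≤n p))
    y∉T : ¬ (o ∸ x) occursIn T
    y∉T (j , p , Tj≡y) = <-irrefl (sym Tj≡y) (below-all p)
    y<N : o ∸ x < N
    y<N = ≤-<-trans (m∸n≤m o x) (subst (o <_) o+1+k≡N (m<m+n o z<s))
    head-ok : ∀ {b c} → b < c → c < k → T ! b < o ∸ x → T ! c < T ! b → ⊥
    head-ok b<c c<k Tb<y _ = <-asym Tb<y (below-all (<-trans b<c c<k))
    nonMin-head : ∀ {l u} → l < k → T ! l < o ∸ x → u < N → ¬ u occursIn (o ∸ x ∷ T) → u < o ∸ x
    nonMin-head l<k Tl<y _ _ = ⊥-elim (<-asym Tl<y (below-all l<k))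
    target-head : suffixMin (o ∸ x ∷ T) ! 0 ≡ o ∸ x
    target-head = suffixMin-new (o ∸ x) T (λ p → <⇒≤ (subst (o ∸ x <_) (sym (next-target p)) new-min))

  -- A target that is not a new minimum equals the previous one (by Steps), so it already occurs in T
  -- and, T being too short to hold all values from it up to N, some larger value is still missing.
  maxMissing-invariant : ∀ o {x} (xs : Vec ℕ k) → o + suc k ≡ N → Steps (x ∷ xs) →
                         ¬ (o ∸ x < suc o ∸ xs ! 0) →
                         ∀ {T} → Invariant (suc o) xs T → Invariant o (x ∷ xs) (maxMissing N T ∷ T)
  maxMissing-invariant o {x} [] _ _ old _ = ⊥-elim (old (s≤s (m∸n≤m o x)))
  maxMissing-invariant {k} o {x} xs@(_ ∷ _) o+1+k≡N steps old {T} inv =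
    ∷-invariant inv y∉T y<N head-ok nonMin-head target-head
    where
    open Invariant inv
    t≡minT : o ∸ x ≡ suffixMin T ! 0
    t≡minT = begin
      o ∸ x                 ≡⟨ ≤-antisym (steps-target-mono o xs steps) (≮⇒≥ old) ⟩
      suc o ∸ xs ! 0        ≡⟨ cong (_∸ xs ! 0) (+-identityʳ (suc o)) ⟨
      (suc o + 0) ∸ xs ! 0  ≡⟨ suffixMin-target z<s ⟨
      suffixMin T ! 0       ∎
      where open ≡-Reasoning
    t-occurs : (o ∸ x) occursIn T
    t-occurs with suffixMin-attained T z<s
    ... | j , _ , j<k , Tj≡min = j , j<k , trans Tj≡min (sym t≡minT)
    k<N∸t : k < N ∸ (o ∸ x)
    k<N∸t = subst (_≤ N ∸ (o ∸ x)) (trans (cong (_∸ o) (sym o+1+k≡N)) (m+n∸m≡n o (suc k)))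
                  (∸-monoʳ-≤ N (m∸n≤m o x))
    y : ℕ
    y = maxMissing N T
    y-facts : o ∸ x < y × y < N × ¬ y occursIn T
    y-facts = maxMissing-above T t-occurs k<N∸t
    t<y : o ∸ x < y
    t<y = proj₁ y-facts
    y<N : y < N
    y<N = proj₁ (proj₂ y-facts)
    y∉T : ¬ y occursIn T
    y∉T = proj₂ (proj₂ y-facts)
    head-ok : ∀ {b c} → b < c → c < k → T ! b < y → T ! c < T ! b → ⊥
    head-ok b<c c<k Tb<y Tc<Tb = <-asym Tb<y (nonMin>missing b<c c<k Tc<Tb y<N y∉T)
    nonMin-head : ∀ {l u} → l < k → T ! l < y → u < N → ¬ u occursIn (y ∷ T) → u < y
    nonMin-head _ _ u<N u∉yT = ≤∧≢⇒< (maxMissing-greatest N T u<N (u∉yT ∘ occursIn-∷))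
                                     (λ u≡y → u∉yT (0 , z<s , sym u≡y))
    target-head : suffixMin (y ∷ T) ! 0 ≡ o ∸ x
    target-head = trans (suffixMin-old y T z<s (subst (_≤ y) t≡minT (<⇒≤ t<y))) (sym t≡minT)

  build-invariant : ∀ o (xs : Vec ℕ k) → o + k ≡ N → Steps xs → Invariant o xs (build o xs)
  build-invariant o [] _ _ = record
    { distinct = λ () ; bounded = λ () ; avoids = λ _ _ () ; nonMin>missing = λ _ () ; suffixMin-target = λ () }
  build-invariant {suc k} o (x ∷ xs) o+k≡N steps
    with o ∸ x <? suc o ∸ xs ! 0
       | build-invariant (suc o) xs (trans (sym (+-suc o k)) o+k≡N) (steps-tail steps)
  ... | yes new-min | IH = new-min-invariant o xs o+k≡N new-min IH
  ... | no  old-min | IH = maxMissing-invariant o xs o+k≡N steps old-min IH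

-- The entries are already below n, so _mod_ only changes their type.
fromSR : Vec ℕ n → Vec (Fin n) n
fromSR {zero}  r = []
fromSR {suc k} r = map (_mod suc k) (Reconstruction.build (suc k) 0 r)

map-toℕ-mod : {T : Vec ℕ n} → (∀ {j} → j < n → T ! j < suc k) → map toℕ (map (_mod suc k) T) ≡ T
map-toℕ-mod {T = []}    _       = refl
map-toℕ-mod {T = x ∷ T} bounded =
  cong₂ _∷_ (trans (FP.toℕ-fromℕ< _) (m<n⇒m%n≡m (bounded z<s))) (map-toℕ-mod (bounded ∘ s≤s))

map-toℕ-fromSR : (r : Vec ℕ n) → (∀ {j} → j < n → Reconstruction.build n 0 r ! j < n) →
                 map toℕ (fromSR r) ≡ Reconstruction.build n 0 r
map-toℕ-fromSR []      _       = refl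
map-toℕ-fromSR (x ∷ r) bounded = map-toℕ-mod bounded

module _ {n} {r : Vec ℕ n} (sr : IsSR r) where
  open Reconstruction n using (build; build-invariant; module Invariant)
  open Invariant (build-invariant 0 r refl (isSR-steps r sr))

  private
    word≡build : map toℕ (fromSR r) ≡ build 0 r
    word≡build = map-toℕ-fromSR r bounded

  fromSR-isPerm : IsPerm (fromSR r)
  fromSR-isPerm = Equivalence.from (isPerm⇔distinct (fromSR r))
    (subst Distinct (sym word≡build) distinct)

  fromSR-avoids : Avoids321 (fromSR r)
  fromSR-avoids = Equivalence.from (avoids321⇔ (fromSR r))
    (subst Avoids321ℕ (sym word≡build) avoids)

  toSR-fromSR : toSR (map toℕ (fromSR r)) ≡ r
  toSR-fromSR = !-extensional _ r λ {i} i<n → begin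
    toSR (map toℕ (fromSR r)) ! i       ≡⟨ cong (λ w → toSR w ! i) word≡build ⟩
    toSR (build 0 r) ! i                ≡⟨ toSR-! (build 0 r) i<n ⟩
    i ∸ suffixMin (build 0 r) ! i       ≡⟨ cong (i ∸_) (suffixMin-target i<n) ⟩
    i ∸ (i ∸ r ! i)                     ≡⟨ m∸[m∸n]≡n (isSR-≤index r sr i<n) ⟩
    r ! i                               ∎
    where open ≡-Reasoning

isolatedPoints-toSR≡fixedPoints : (π : Vec (Fin n) n) → IsPerm π → Avoids321 π →
                                  isolatedPoints (toSR (map toℕ π)) ≡ fixedPoints π
isolatedPoints-toSR≡fixedPoints π perm avoids =
  trans (isolatedPoints-toSR (isPermWord π perm) (Equivalence.to (avoids321⇔ π) avoids))
        (sym (fixedPoints-count π))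

theorem3p4 : (n k : ℕ) → k ≤ n →
    SubsetBij {Vec (Fin n) n} {Vec ℕ n} (Perm321 n k) (SRk n k)
theorem3p4 n k _ = toSR ∘ map toℕ , fromSR , toSR-sound , fromSR-sound , fromSR∘toSR , toSR∘fromSR
  where
  toSR-sound : ∀ π → Perm321 n k π → SRk n k (toSR (map toℕ π))
  toSR-sound π (perm , avoids , fixed≡k) =
    toSR-isSR (map toℕ π) , trans (isolatedPoints-toSR≡fixedPoints π perm avoids) fixed≡k

  fromSR-sound : ∀ r → SRk n k r → Perm321 n k (fromSR r)
  fromSR-sound r (sr , isolated≡k) = perm , avoids , (begin
    fixedPoints (fromSR r)                      ≡⟨ isolatedPoints-toSR≡fixedPoints (fromSR r) perm avoids ⟨
    isolatedPoints (toSR (map toℕ (fromSR r)))  ≡⟨ cong isolatedPoints (toSR-fromSR sr) ⟩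
    isolatedPoints r                            ≡⟨ isolated≡k ⟩
    k                                           ∎)
    where
    open ≡-Reasoning
    perm : IsPerm (fromSR r)
    perm = fromSR-isPerm sr
    avoids : Avoids321 (fromSR r)
    avoids = fromSR-avoids sr

  fromSR∘toSR : ∀ π → Perm321 n k π → fromSR (toSR (map toℕ π)) ≡ π
  fromSR∘toSR π (perm , avoids , _) = map-toℕ-injective π′ π
    (toSR-injective (isPermWord π′ (fromSR-isPerm sr)) (Equivalence.to (avoids321⇔ π′) (fromSR-avoids sr))
                    (isPermWord π perm) (Equivalence.to (avoids321⇔ π) avoids)
                    (toSR-fromSR sr))
    where
    sr : IsSR (toSR (map toℕ π))
    sr = toSR-isSR (map toℕ π)
    π′ : Vec (Fin n) n
    π′ = fromSR (toSR (map toℕ π))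

  toSR∘fromSR : ∀ r → SRk n k r → toSR (map toℕ (fromSR r)) ≡ r
  toSR∘fromSR r (sr , _) = toSR-fromSR sr
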